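{- The category $\mathbf{FrmSim}$ is equivalent to the category $\mathbf{CABAOSim}$; the equivalence is given by the lower-lifting functor $R \mapsto \mathrm{Low}(R)$ (with objects $(X,R) \mapsto (\mathcal{P}(X), \Box_R)$), with pseudo-inverse given by restricting relations to atoms.
   Context: A Kripke frame $(X,R)$ is a set $X$ with a relation $R \subseteq X \times X$. For a relation $Q \subseteq X \times Y$, its lower relation $\mathrm{Low}(Q) \subseteq \mathcal{P}(X) \times \mathcal{P}(Y)$ is defined by $S \mathrel{\mathrm{Low}(Q)} T$ iff $\forall s \in S.\ \exists t \in T.\ s \mathrel{Q} t$. A relation $Q \subseteq X \times Y$ between frames $(X,R)$ and $(Y,S)$ is a simulation if $x \mathrel{Q} y$ and $x \mathrel{R} x'$ imply there is $y'$ with $y \mathrel{S} y'$ and $x' \mathrel{Q} y'$. $\mathbf{FrmSim}$ has Kripke frames as objects and simulations as morphisms (relational composition, identity relations). A CABA is a complete atomic Boolean algebra. A relation $Q \subseteq \mathcal{B} \times \mathcal{B}'$ between CABAs is directionally atomic if it is (a) a bimodule: $p' \sqsubseteq p \mathrel{Q} q \sqsubseteq q'$ implies $p' \mathrel{Q} q'$; (b) left-disjunctive: $a_i \mathrel{Q} b$ for all $i \in I$ implies $(\bigsqcup_i a_i) \mathrel{Q} b$; (c) atomic-founded: if $a$ is an atom and $a \mathrel{Q} b$ then there is an atom $b' \sqsubseteq b$ with $a \mathrel{Q} b'$. A CABAO $(\mathcal{B}, \Box_{\mathcal{B}})$ is a CABA with a meet-preserving operator $\Box_{\mathcal{B}}$;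 write $\Diamond^{ - }_{\mathcal{B}}$ for its left adjoint, the unique join-preserving map with $\Diamond^{ - }_{\mathcal{B}} x \sqsubseteq y$ iff $x \sqsubseteq \Box_{\mathcal{B}} y$. For a frame $(X,R)$, $\Box_R(A) = \{w \mid \forall v.\ w \mathrel{R} v \Rightarrow v \in A\}$ and $\Diamond^{ - }_R(A) = \{w \mid \exists v \in A.\ v \mathrel{R} w\}$. A simulatory relation $Q : (\mathcal{B}, \Box_{\mathcal{B}}) \to (\mathcal{B}', \Box_{\mathcal{B}'})$ is a directionally atomic $Q \subseteq \mathcal{B} \times \mathcal{B}'$ such that $A \mathrel{Q} \Box_{\mathcal{B}'} B$ implies $\Diamond^{ - }_{\mathcal{B}} A \mathrel{Q} B$. $\mathbf{CABAOSim}$ has CABAOs as objects and simulatory relations as morphisms, with relational composition and identity $\sqsubseteq$. -}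

module Defs where

open import Data.Bool using (Bool; true; false; if_then_else_)
open import Data.Empty using (⊥) renaming (⊥-elim to ⊥-elim)
open import Data.Product using (Σ; _×_; _,_; proj₁; proj₂; ∃)
open import Data.Sum using (_⊎_)
open import Function using (_∘_)
open import Relation.Nullary using (¬_; Dec; does)
open import Relation.Binary.PropositionalEquality using (_≡_)

LEM : Set₁
LEM = (P : Set) → Dec P

Rel : Set → Set → Set₁
Rel X Y = X → Y → Set

_⨾_ : {X Y Z : Set} → Rel X Y → Rel Y Z → Rel X Z
(Q ⨾ Q') x z = Σ _ λ y → Q x y × Q' y z

_⇔ᵣ_ : {X Y : Set} → Rel X Y → Rel X Y → Set
Q ⇔ᵣ Q' = ∀ x y → (Q x y → Q' x y) × (Q' x y → Q x y)

IdRel : (X : Set) → Rel X X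
IdRel X x y = x ≡ y

record Frame : Set₁ where
  field
    W : Set
    R : W → W → Set
open Frame public

IsSimulation : (F G : Frame) → Rel (W F) (W G) → Set
IsSimulation F G Q =
  ∀ x y x' → Q x y → R F x x' → Σ (W G) λ y' → R G y y' × Q x' y'

-- Powersets (subsets as characteristic functions, classical reading)

Sub : Set → Set
Sub X = X → Bool

_∈_ : {X : Set} → X → Sub X → Set
x ∈ S = S x ≡ true

Low : {X Y : Set} → Rel X Y → Rel (Sub X) (Sub Y)
Low Q S T = ∀ s → s ∈ S → Σ _ λ t → t ∈ T × Q s t

record RawCABAO : Set₁ where
  field
    Carrier : Set
    _⊑_     : Carrier → Carrier → Set
    ⋁       : {I : Set} → (I → Carrier) → Carrier
    ⋀       : {I : Set} → (I → Carrier) → Carrier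
    ∁       : Carrier → Carrier
    □       : Carrier → Carrier

  bot : Carrier
  bot = ⋁ {⊥} ⊥-elim

  top : Carrier
  top = ⋀ {⊥} ⊥-elim

  _⊓_ : Carrier → Carrier → Carrier
  x ⊓ y = ⋀ {Bool} (λ b → if b then x else y)

  _⊔_ : Carrier → Carrier → Carrier
  x ⊔ y = ⋁ {Bool} (λ b → if b then x else y)

  IsAtom : Carrier → Set
  IsAtom a = ¬ (a ≡ bot) × (∀ b → b ⊑ a → (b ≡ bot) ⊎ (b ≡ a))

  Atom : Set
  Atom = Σ Carrier IsAtom

  -- left adjoint of □ : ◇⁻ x = ⋀ { y ∣ x ⊑ □ y }
  ◇⁻ : Carrier → Carrier
  ◇⁻ x = ⋀ {Σ Carrier λ y → x ⊑ □ y} proj₁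


record IsCABAO (B : RawCABAO) : Set₁ where
  open RawCABAO B using (Carrier; _⊑_; ⋁; ⋀; ∁; □; bot; top; _⊓_; _⊔_; IsAtom)
  field
    ⊑-prop    : ∀ {x y} (p q : x ⊑ y) → p ≡ q
    ⊑-refl    : ∀ x → x ⊑ x
    ⊑-trans   : ∀ {x y z} → x ⊑ y → y ⊑ z → x ⊑ z
    ⊑-antisym : ∀ {x y} → x ⊑ y → y ⊑ x → x ≡ y
    ⋁-upper   : ∀ {I} (f : I → Carrier) i → f i ⊑ ⋁ f
    ⋁-least   : ∀ {I} (f : I → Carrier) y → (∀ i → f i ⊑ y) → ⋁ f ⊑ y
    ⋀-lower   : ∀ {I} (f : I → Carrier) i → ⋀ f ⊑ f i
    ⋀-greatest : ∀ {I} (f : I → Carrier) y → (∀ i → y ⊑ f i) → y ⊑ ⋀ f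
    distrib   : ∀ x y z → (x ⊓ (y ⊔ z)) ⊑ ((x ⊓ y) ⊔ (x ⊓ z))
    ∁-⊓       : ∀ x → (x ⊓ ∁ x) ⊑ bot
    ∁-⊔       : ∀ x → top ⊑ (x ⊔ ∁ x)
    atomic    : ∀ x → x ⊑ ⋁ {Σ Carrier λ a → IsAtom a × a ⊑ x} proj₁
    □-meets   : ∀ {I} (f : I → Carrier) → □ (⋀ f) ≡ ⋀ (□ ∘ f)

open RawCABAO public

record CABAO : Set₂ where
  field
    raw     : RawCABAO
    isCABAO : IsCABAO raw
open CABAO public

module _ (B B' : RawCABAO) (Q : Rel (Carrier B) (Carrier B')) where
  IsBimodule : Set
  IsBimodule = ∀ p' p q q' → _⊑_ B p' p → Q p q → _⊑_ B' q q' → Q p' q'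

  IsLeftDisjunctive : Set₁
  IsLeftDisjunctive = ∀ {I : Set} (a : I → Carrier B) b →
    (∀ i → Q (a i) b) → Q (⋁ B a) b

  IsAtomicFounded : Set
  IsAtomicFounded = ∀ a b → IsAtom B a → Q a b →
    Σ (Carrier B') λ b' → IsAtom B' b' × _⊑_ B' b' b × Q a b'

  IsDirectionallyAtomic : Set₁
  IsDirectionallyAtomic = IsBimodule × IsLeftDisjunctive × IsAtomicFounded

  IsSimulatory : Set₁
  IsSimulatory = IsDirectionallyAtomic ×
    (∀ A C → Q A (□ B' C) → Q (◇⁻ B A) C)

IdC : (B : RawCABAO) → Rel (Carrier B) (Carrier B)
IdC B = _⊑_ B

-- Object part of the lower-lifting functor: (X,R) ↦ (P(X), □_R)

PowRaw : LEM → Frame → RawCABAO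
PowRaw lem F = record
  { Carrier = Sub (W F)
  ; _⊑_ = λ A C → ∀ x → x ∈ A → x ∈ C
  ; ⋁ = λ {I} f x → does (lem (Σ I λ i → x ∈ f i))
  ; ⋀ = λ {I} f x → does (lem (∀ i → x ∈ f i))
  ; ∁ = λ A x → if A x then false else true
  ; □ = λ A w → does (lem (∀ v → R F w v → v ∈ A))
  }

-- Object part of the pseudo-inverse: restrict to atoms.
-- The frame of atoms of B, with  a R b  iff  b ⊑ ◇⁻ a.

AtFrm : RawCABAO → Frame
AtFrm B = record
  { W = Atom B
  ; R = λ a b → _⊑_ B (proj₁ b) (◇⁻ B (proj₁ a))
  }

restrict : (B B' : RawCABAO) → Rel (Carrier B) (Carrier B') →
           Rel (Atom B) (Atom B')
restrict B B' Q a b = Q (proj₁ a) (proj₁ b)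

-- The (unpacked) statement that Low / restriction-to-atoms form an
-- equivalence of categories FrmSim ≃ CABAOSim.

record LowAtomsEquivalence (lem : LEM) : Set₂ where
  Pow : Frame → RawCABAO
  Pow = PowRaw lem
  field
    Pow-isCABAO : ∀ X → IsCABAO (Pow X)
    Low-simulatory : ∀ X Y (Q : Rel (W X) (W Y)) → IsSimulation X Y Q →
      IsSimulatory (Pow X) (Pow Y) (Low Q)
    Low-id : ∀ X → Low (IdRel (W X)) ⇔ᵣ IdC (Pow X)
    Low-⨾ : ∀ X Y Z (Q : Rel (W X) (W Y)) (Q' : Rel (W Y) (W Z)) →
      IsSimulation X Y Q → IsSimulation Y Z Q' →
      Low (Q ⨾ Q') ⇔ᵣ (Low Q ⨾ Low Q')
    restrict-simulation : ∀ (B B' : CABAO) (Q : Rel (Carrier (raw B)) (Carrier (raw B'))) →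
      IsSimulatory (raw B) (raw B') Q →
      IsSimulation (AtFrm (raw B)) (AtFrm (raw B')) (restrict (raw B) (raw B') Q)
    restrict-id : ∀ (B : CABAO) →
      restrict (raw B) (raw B) (IdC (raw B)) ⇔ᵣ IdRel (Atom (raw B))
    restrict-⨾ : ∀ (B B' B'' : CABAO)
      (Q : Rel (Carrier (raw B)) (Carrier (raw B')))
      (Q' : Rel (Carrier (raw B')) (Carrier (raw B''))) →
      IsSimulatory (raw B) (raw B') Q → IsSimulatory (raw B') (raw B'') Q' →
      restrict (raw B) (raw B'') (Q ⨾ Q') ⇔ᵣ
        (restrict (raw B) (raw B') Q ⨾ restrict (raw B') (raw B'') Q')
    η  : ∀ X → Rel (W X) (Atom (Pow X))
    η⁻ : ∀ X → Rel (Atom (Pow X)) (W X)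
    η-sim  : ∀ X → IsSimulation X (AtFrm (Pow X)) (η X)
    η⁻-sim : ∀ X → IsSimulation (AtFrm (Pow X)) X (η⁻ X)
    η-iso₁ : ∀ X → (η X ⨾ η⁻ X) ⇔ᵣ IdRel (W X)
    η-iso₂ : ∀ X → (η⁻ X ⨾ η X) ⇔ᵣ IdRel (Atom (Pow X))
    η-natural : ∀ X Y (Q : Rel (W X) (W Y)) → IsSimulation X Y Q →
      (η X ⨾ restrict (Pow X) (Pow Y) (Low Q)) ⇔ᵣ (Q ⨾ η Y)
    ε  : ∀ (B : CABAO) → Rel (Carrier (Pow (AtFrm (raw B)))) (Carrier (raw B))
    ε⁻ : ∀ (B : CABAO) → Rel (Carrier (raw B)) (Carrier (Pow (AtFrm (raw B))))
    ε-sim  : ∀ B → IsSimulatory (Pow (AtFrm (raw B))) (raw B) (ε B)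
    ε⁻-sim : ∀ B → IsSimulatory (raw B) (Pow (AtFrm (raw B))) (ε⁻ B)
    ε-iso₁ : ∀ B → (ε B ⨾ ε⁻ B) ⇔ᵣ IdC (Pow (AtFrm (raw B)))
    ε-iso₂ : ∀ B → (ε⁻ B ⨾ ε B) ⇔ᵣ IdC (raw B)
    ε-natural : ∀ (B B' : CABAO) (Q : Rel (Carrier (raw B)) (Carrier (raw B'))) →
      IsSimulatory (raw B) (raw B') Q →
      (Low (restrict (raw B) (raw B') Q) ⨾ ε B') ⇔ᵣ (ε B ⨾ Q)

{-# OPTIONS --safe #-}
-- A powerset is a CABA whose atoms are the singletons, and a CABA B is the
-- powerset of its atoms via S ↦ ⋁ S, because atoms are completely join-prime
-- (an atom below ⋁ f lies below some f i); these give the unit x ↦ {x} and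
-- the counit S ↦ ⋁ S.  In a powerset, ◇⁻ A is the R-image of A, so the frame
-- on atoms (a R b iff b ⊑ ◇⁻ a) recovers R, and the simulatory condition
-- A Q □ C ⇒ ◇⁻ A Q C is the simulation clause lifted to sets.  On morphisms,
-- atomic-foundedness lets every step of Q out of an atom end in an atom, which
-- makes restriction to atoms functorial and, with left-disjunctivity, makes
-- the counit natural.
module Submission where

open import Defs
open import Axiom.Extensionality.Propositional using (Extensionality)
open import Axiom.UniquenessOfIdentityProofs.WithK using (uip)
open import Level using (0ℓ)
open import Data.Bool using (true; false)
open import Data.Bool.Properties using (⇔→≡)
open import Data.Empty using (⊥-elim)
open import Data.Product using (Σ; _×_; _,_; proj₁; proj₂)
open import Data.Sum as Sum using (_⊎_; inj₁; inj₂)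
open import Function using (_∘_)
open import Function.Bundles using (mk⇔)
open import Relation.Nullary using (¬_; Irrelevant; does; yes; no)
open import Relation.Nullary.Decidable using (dec-true; does-⇔)
open import Relation.Binary.PropositionalEquality
  using (_≡_; refl; sym; trans; cong; cong₂; subst)

module Classical (lem : LEM) where

  holds : {P : Set} → P → does (lem P) ≡ true
  holds {P} = dec-true (lem P)

  witness : {P : Set} → does (lem P) ≡ true → P
  witness {P} _  with lem P
  witness     _  | yes p = p
  witness     () | no _

  ⟦_⟧ : {A : Set} → (A → Set) → Sub A
  ⟦ P ⟧ x = does (lem (P x))

_⊆_ : {A : Set} → Sub A → Sub A → Set
S ⊆ U = ∀ x → x ∈ S → x ∈ U

module Atoms (ext : Extensionality 0ℓ 0ℓ) (B : RawCABAO) where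

  IsAtom-irrelevant : ∀ {a} → Irrelevant (IsAtom B a)
  IsAtom-irrelevant {a} (a≢⊥ , below) (_ , below′) =
    cong₂ _,_ (ext λ a≡⊥ → ⊥-elim (a≢⊥ a≡⊥))
              (ext λ b → ext λ b⊑a → bot-or-a-irrelevant (below b b⊑a) (below′ b b⊑a))
    where
    bot-or-a-irrelevant : ∀ {b} → Irrelevant ((b ≡ bot B) ⊎ (b ≡ a))
    bot-or-a-irrelevant (inj₁ p) (inj₁ q) = cong inj₁ (uip p q)
    bot-or-a-irrelevant (inj₁ p) (inj₂ q) = ⊥-elim (a≢⊥ (trans (sym q) p))
    bot-or-a-irrelevant (inj₂ p) (inj₁ q) = ⊥-elim (a≢⊥ (trans (sym p) q))
    bot-or-a-irrelevant (inj₂ p) (inj₂ q) = cong inj₂ (uip p q)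

  Atom-≡ : {a c : Atom B} → proj₁ a ≡ proj₁ c → a ≡ c
  Atom-≡ {a , p} {.a , q} refl = cong (a ,_) (IsAtom-irrelevant p q)

module CABAOLaws (B : CABAO) where
  open IsCABAO (isCABAO B) public

  𝔹 : RawCABAO
  𝔹 = raw B

  infix 4 _≤_
  infixl 6 _∧_
  infixl 5 _∨_

  _≤_ : Carrier 𝔹 → Carrier 𝔹 → Set
  _≤_ = _⊑_ 𝔹

  _∧_ : Carrier 𝔹 → Carrier 𝔹 → Carrier 𝔹
  _∧_ = _⊓_ 𝔹

  _∨_ : Carrier 𝔹 → Carrier 𝔹 → Carrier 𝔹
  _∨_ = _⊔_ 𝔹

  ≤-reflexive : ∀ {x y} → x ≡ y → x ≤ y
  ≤-reflexive refl = ⊑-refl _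

  bot-least : ∀ x → bot 𝔹 ≤ x
  bot-least x = ⋁-least ⊥-elim x λ ()

  top-greatest : ∀ x → x ≤ top 𝔹
  top-greatest x = ⋀-greatest ⊥-elim x λ ()

  x∧y≤x : ∀ x y → x ∧ y ≤ x
  x∧y≤x x y = ⋀-lower _ true

  x∧y≤y : ∀ x y → x ∧ y ≤ y
  x∧y≤y x y = ⋀-lower _ false

  ∧-greatest : ∀ {x y z} → z ≤ x → z ≤ y → z ≤ x ∧ y
  ∧-greatest {z = z} z≤x z≤y = ⋀-greatest _ z λ { true → z≤x ; false → z≤y }

  ∨-least : ∀ {x y z} → x ≤ z → y ≤ z → x ∨ y ≤ z
  ∨-least {z = z} x≤z y≤z = ⋁-least _ z λ { true → x≤z ; false → y≤z }

  x∧y≤⊥⇒x≤∁y : ∀ {x y} → x ∧ y ≤ bot 𝔹 → x ≤ ∁ 𝔹 y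
  x∧y≤⊥⇒x≤∁y {x} {y} x∧y≤⊥ =
    ⊑-trans (∧-greatest (⊑-refl x) (⊑-trans (top-greatest x) (∁-⊔ y)))
      (⊑-trans (distrib x y (∁ 𝔹 y))
        (∨-least (⊑-trans x∧y≤⊥ (bot-least _)) (x∧y≤y x (∁ 𝔹 y))))

  atom≤atom⇒≡ : ∀ {a c} → IsAtom 𝔹 a → IsAtom 𝔹 c → a ≤ c → a ≡ c
  atom≤atom⇒≡ (a≢⊥ , _) (_ , below-c) a≤c with below-c _ a≤c
  ... | inj₁ a≡⊥ = ⊥-elim (a≢⊥ a≡⊥)
  ... | inj₂ a≡c = a≡c

  ≤□⇒◇⁻≤ : ∀ {x y} → x ≤ □ 𝔹 y → ◇⁻ 𝔹 x ≤ y
  ≤□⇒◇⁻≤ {y = y} x≤□y = ⋀-lower proj₁ (y , x≤□y)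

  □-mono : ∀ {x y} → x ≤ y → □ 𝔹 x ≤ □ 𝔹 y
  □-mono {x} {y} x≤y = subst (λ z → □ 𝔹 z ≤ □ 𝔹 y) x∧y≡x □[x∧y]≤□y
    where
    x∧y≡x : x ∧ y ≡ x
    x∧y≡x = ⊑-antisym (x∧y≤x x y) (∧-greatest (⊑-refl x) x≤y)
    □[x∧y]≤□y : □ 𝔹 (x ∧ y) ≤ □ 𝔹 y
    □[x∧y]≤□y = subst (_≤ □ 𝔹 y) (sym (□-meets _)) (⋀-lower _ false)

  x≤□◇⁻x : ∀ x → x ≤ □ 𝔹 (◇⁻ 𝔹 x)
  x≤□◇⁻x x = subst (x ≤_) (sym (□-meets _)) (⋀-greatest _ x proj₂)

  ◇⁻≤⇒≤□ : ∀ {x y} → ◇⁻ 𝔹 x ≤ y → x ≤ □ 𝔹 y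
  ◇⁻≤⇒≤□ {x} ◇⁻x≤y = ⊑-trans (x≤□◇⁻x x) (□-mono ◇⁻x≤y)

  module _ (lem : LEM) where

    -- If a is below no f i it is disjoint from each of them, hence below
    -- m = ⋀ᵢ ∁ (f i), while ⋁ f ≤ ∁ m; so a ≤ m ∧ ∁ m ≤ ⊥.
    atom≤⋁⇒≤some : ∀ {I} (f : I → Carrier 𝔹) {a} → IsAtom 𝔹 a → a ≤ ⋁ 𝔹 f →
                   Σ I λ i → a ≤ f i
    atom≤⋁⇒≤some {I} f {a} (a≢⊥ , below-a) a≤⋁f with lem (Σ I λ i → a ≤ f i)
    ... | yes below-some = below-some
    ... | no  below-none = ⊥-elim (a≢⊥ (⊑-antisym a≤⊥ (bot-least a)))
      where
      m : Carrier 𝔹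
      m = ⋀ 𝔹 (∁ 𝔹 ∘ f)
      a∧fi≤⊥ : ∀ i → a ∧ f i ≤ bot 𝔹
      a∧fi≤⊥ i with below-a (a ∧ f i) (x∧y≤x a (f i))
      ... | inj₁ a∧fi≡⊥ = ≤-reflexive a∧fi≡⊥
      ... | inj₂ a∧fi≡a = ⊥-elim (below-none (i , subst (_≤ f i) a∧fi≡a (x∧y≤y a (f i))))
      fi≤∁m : ∀ i → f i ≤ ∁ 𝔹 m
      fi≤∁m i = x∧y≤⊥⇒x≤∁y (⊑-trans (∧-greatest (x∧y≤x (f i) m)
                                                  (⊑-trans (x∧y≤y (f i) m) (⋀-lower _ i)))
                                     (∁-⊓ (f i)))
      a≤⊥ : a ≤ bot 𝔹
      a≤⊥ = ⊑-trans (∧-greatest (⋀-greatest _ a (x∧y≤⊥⇒x≤∁y ∘ a∧fi≤⊥))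
                                (⊑-trans a≤⋁f (⋁-least f _ fi≤∁m)))
                    (∁-⊓ m)

module Powerset (lem : LEM) (ext : Extensionality 0ℓ 0ℓ) (X : Frame) where
  open Classical lem

  𝒫 : RawCABAO
  𝒫 = PowRaw lem X

  ⊆-antisym : {A C : Sub (W X)} → A ⊆ C → C ⊆ A → A ≡ C
  ⊆-antisym A⊆C C⊆A = ext λ x → ⇔→≡ (mk⇔ (A⊆C x) (C⊆A x))

  ∉bot : ∀ {x} → ¬ x ∈ bot 𝒫
  ∉bot x∈⊥ = proj₁ (witness x∈⊥)

  empty⇒≡bot : ∀ {A} → (∀ x → ¬ x ∈ A) → A ≡ bot 𝒫
  empty⇒≡bot empty =
    ⊆-antisym (λ x x∈A → ⊥-elim (empty x x∈A)) (λ _ x∈⊥ → ⊥-elim (∉bot x∈⊥))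

  ∈-∧⁻ : ∀ {A C x} → x ∈ _⊓_ 𝒫 A C → x ∈ A × x ∈ C
  ∈-∧⁻ x∈A∧C = witness x∈A∧C true , witness x∈A∧C false

  ∈-∧⁺ : ∀ {A C x} → x ∈ A → x ∈ C → x ∈ _⊓_ 𝒫 A C
  ∈-∧⁺ x∈A x∈C = holds λ { true → x∈A ; false → x∈C }

  ∈-∨⁻ : ∀ {A C x} → x ∈ _⊔_ 𝒫 A C → x ∈ A ⊎ x ∈ C
  ∈-∨⁻ x∈A∨C with witness x∈A∨C
  ... | true  , x∈A = inj₁ x∈A
  ... | false , x∈C = inj₂ x∈C

  ∈-∨⁺ : ∀ {A C x} → x ∈ A ⊎ x ∈ C → x ∈ _⊔_ 𝒫 A C
  ∈-∨⁺ (inj₁ x∈A) = holds (true , x∈A)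
  ∈-∨⁺ (inj₂ x∈C) = holds (false , x∈C)

  ∈∁⇒∉ : ∀ A x → x ∈ ∁ 𝒫 A → ¬ x ∈ A
  ∈∁⇒∉ A x with A x
  ... | true  = λ ()
  ... | false = λ _ ()

  ∈-or-∈∁ : ∀ A x → x ∈ A ⊎ x ∈ ∁ 𝒫 A
  ∈-or-∈∁ A x with A x
  ... | true  = inj₁ refl
  ... | false = inj₂ refl

  ｛_｝ : W X → Sub (W X)
  ｛ x ｝ = ⟦ _≡ x ⟧

  x∈｛x｝ : ∀ {x} → x ∈ ｛ x ｝
  x∈｛x｝ = holds refl

  ｛x｝⊆ : ∀ {A x} → x ∈ A → ｛ x ｝ ⊆ A
  ｛x｝⊆ {A} x∈A y y∈｛x｝ = subst (_∈ A) (sym (witness y∈｛x｝)) x∈A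

  ｛｝-isAtom : ∀ x → IsAtom 𝒫 ｛ x ｝
  ｛｝-isAtom x = ｛x｝≢⊥ , below-｛x｝
    where
    ｛x｝≢⊥ : ¬ ｛ x ｝ ≡ bot 𝒫
    ｛x｝≢⊥ ｛x｝≡⊥ = ∉bot (subst (x ∈_) ｛x｝≡⊥ x∈｛x｝)
    below-｛x｝ : ∀ C → C ⊆ ｛ x ｝ → (C ≡ bot 𝒫) ⊎ (C ≡ ｛ x ｝)
    below-｛x｝ C C⊆｛x｝ with lem (x ∈ C)
    ... | yes x∈C = inj₂ (⊆-antisym C⊆｛x｝ (｛x｝⊆ x∈C))
    ... | no  x∉C = inj₁ (empty⇒≡bot λ y y∈C →
                            x∉C (subst (_∈ C) (witness (C⊆｛x｝ y y∈C)) y∈C))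

  ｛_｝ₐ : W X → Atom 𝒫
  ｛ x ｝ₐ = ｛ x ｝ , ｛｝-isAtom x

  atom-inhabited : ∀ {A} → IsAtom 𝒫 A → Σ (W X) (_∈ A)
  atom-inhabited {A} (A≢⊥ , _) with lem (Σ (W X) (_∈ A))
  ... | yes inhabited = inhabited
  ... | no  empty     = ⊥-elim (A≢⊥ (empty⇒≡bot λ x x∈A → empty (x , x∈A)))

  atom≡｛｝ : ∀ {A x} → IsAtom 𝒫 A → x ∈ A → A ≡ ｛ x ｝
  atom≡｛｝ {x = x} (_ , below-A) x∈A with below-A ｛ x ｝ (｛x｝⊆ x∈A)
  ... | inj₁ ｛x｝≡⊥ = ⊥-elim (proj₁ (｛｝-isAtom x) ｛x｝≡⊥)
  ... | inj₂ ｛x｝≡A = sym ｛x｝≡A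

  atom-subsingleton : ∀ {A x y} → IsAtom 𝒫 A → x ∈ A → y ∈ A → y ≡ x
  atom-subsingleton {y = y} A-atom x∈A y∈A = witness (subst (y ∈_) (atom≡｛｝ A-atom x∈A) y∈A)

  ∈◇⁻⁺ : ∀ {A v w} → v ∈ A → R X v w → w ∈ ◇⁻ 𝒫 A
  ∈◇⁻⁺ v∈A vRw = holds λ (_ , A⊆□D) → witness (A⊆□D _ v∈A) _ vRw

  ∈◇⁻⁻ : ∀ {A w} → w ∈ ◇⁻ 𝒫 A → Σ (W X) λ v → v ∈ A × R X v w
  ∈◇⁻⁻ {A} w∈◇⁻A = witness (witness w∈◇⁻A (image , A⊆□image))
    where
    image : Sub (W X)
    image = ⟦ (λ u → Σ (W X) λ v → v ∈ A × R X v u) ⟧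
    A⊆□image : A ⊆ □ 𝒫 image
    A⊆□image v v∈A = holds λ u vRu → holds (v , v∈A , vRu)

  Pow-isCABAO : IsCABAO 𝒫
  Pow-isCABAO = record
    { ⊑-prop     = λ _ _ → ext λ _ → ext λ _ → uip _ _
    ; ⊑-refl     = λ _ _ x∈A → x∈A
    ; ⊑-trans    = λ A⊆C C⊆D x x∈A → C⊆D x (A⊆C x x∈A)
    ; ⊑-antisym  = ⊆-antisym
    ; ⋁-upper    = λ _ i _ x∈fi → holds (i , x∈fi)
    ; ⋁-least    = λ _ _ fi⊆C x x∈⋁f → let (i , x∈fi) = witness x∈⋁f in fi⊆C i x x∈fi
    ; ⋀-lower    = λ _ i _ x∈⋀f → witness x∈⋀f i
    ; ⋀-greatest = λ _ _ C⊆fi x x∈C → holds λ i → C⊆fi i x x∈C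
    ; distrib    = λ _ _ _ _ x∈ →
        let (x∈A , x∈C∨D) = ∈-∧⁻ x∈
        in ∈-∨⁺ (Sum.map (∈-∧⁺ x∈A) (∈-∧⁺ x∈A) (∈-∨⁻ x∈C∨D))
    ; ∁-⊓        = λ A x x∈ → let (x∈A , x∈∁A) = ∈-∧⁻ x∈ in ⊥-elim (∈∁⇒∉ A x x∈∁A x∈A)
    ; ∁-⊔        = λ A x _ → ∈-∨⁺ (∈-or-∈∁ A x)
    ; atomic     = λ _ x x∈A → holds ((｛ x ｝ , ｛｝-isAtom x , ｛x｝⊆ x∈A) , x∈｛x｝)
    ; □-meets    = □-meets
    }
    where
    □-meets : ∀ {I} (f : I → Sub (W X)) → □ 𝒫 (⋀ 𝒫 f) ≡ ⋀ 𝒫 (□ 𝒫 ∘ f)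
    □-meets f = ext λ w → does-⇔
      (mk⇔ (λ h i → holds λ v wRv → witness (h v wRv) i)
           (λ h v wRv → holds λ i → witness (h i) v wRv))
      (lem (∀ v → R X w v → v ∈ ⋀ 𝒫 f)) (lem (∀ i → w ∈ □ 𝒫 (f i)))

module Unit (lem : LEM) (ext : Extensionality 0ℓ 0ℓ) (X : Frame) where
  open Classical lem
  open Powerset lem ext X
  open Atoms ext 𝒫

  η : Rel (W X) (Atom 𝒫)
  η x a = x ∈ proj₁ a

  η⁻ : Rel (Atom 𝒫) (W X)
  η⁻ a x = x ∈ proj₁ a

  η-sim : IsSimulation X (AtFrm 𝒫) η
  η-sim _ _ x′ x∈A xRx′ = ｛ x′ ｝ₐ , ｛x｝⊆ (∈◇⁻⁺ x∈A xRx′) , x∈｛x｝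

  η⁻-sim : IsSimulation (AtFrm 𝒫) X η⁻
  η⁻-sim (_ , A-atom) x (_ , A′-atom) x∈A A′⊆◇⁻A with atom-inhabited A′-atom
  ... | y , y∈A′ with ∈◇⁻⁻ (A′⊆◇⁻A y y∈A′)
  ... | v , v∈A , vRy =
    y , subst (λ u → R X u y) (atom-subsingleton A-atom x∈A v∈A) vRy , y∈A′

  η-iso₁ : (η ⨾ η⁻) ⇔ᵣ IdRel (W X)
  η-iso₁ x y = (λ (a , x∈a , y∈a) → sym (atom-subsingleton (proj₂ a) x∈a y∈a))
             , λ { refl → ｛ x ｝ₐ , x∈｛x｝ , x∈｛x｝ }

  η-iso₂ : (η⁻ ⨾ η) ⇔ᵣ IdRel (Atom 𝒫)
  η-iso₂ (A , A-atom) (C , C-atom) =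
      (λ (x , x∈A , x∈C) → Atom-≡ (trans (atom≡｛｝ A-atom x∈A) (sym (atom≡｛｝ C-atom x∈C))))
    , λ { refl → let (x , x∈A) = atom-inhabited A-atom in x , x∈A , x∈A }

Low-id : {A : Set} → Low (IdRel A) ⇔ᵣ _⊆_
Low-id S U =
    (λ S-low-U x x∈S → let (y , y∈U , x≡y) = S-low-U x x∈S in subst (_∈ U) (sym x≡y) y∈U)
  , λ S⊆U x x∈S → x , S⊆U x x∈S , refl

module LowerLifting (lem : LEM) (ext : Extensionality 0ℓ 0ℓ) where
  open Classical lem

  Low-⨾ : {A B C : Set} (Q : Rel A B) (Q′ : Rel B C) → Low (Q ⨾ Q′) ⇔ᵣ (Low Q ⨾ Low Q′)
  Low-⨾ {B = B} Q Q′ S U = to , from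
    where
    preimage : Sub B
    preimage = ⟦ (λ y → Σ _ λ u → u ∈ U × Q′ y u) ⟧
    to : Low (Q ⨾ Q′) S U → (Low Q ⨾ Low Q′) S U
    to S-low-U =
        preimage
      , (λ s s∈S → let (u , u∈U , y , sQy , yQ′u) = S-low-U s s∈S
                   in y , holds (u , u∈U , yQ′u) , sQy)
      , λ _ y∈preimage → witness y∈preimage
    from : (Low Q ⨾ Low Q′) S U → Low (Q ⨾ Q′) S U
    from (T , S-low-T , T-low-U) s s∈S =
      let (t , t∈T , sQt) = S-low-T s s∈S
          (u , u∈U , tQ′u) = T-low-U t t∈T
      in u , u∈U , t , sQt , tQ′u

  Low-simulatory : ∀ X Y (Q : Rel (W X) (W Y)) → IsSimulation X Y Q →
                   IsSimulatory (PowRaw lem X) (PowRaw lem Y) (Low Q)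
  Low-simulatory X Y Q Q-sim = (bimodule , left-disjunctive , atomic-founded) , simulatory
    where
    module PX = Powerset lem ext X
    module PY = Powerset lem ext Y
    bimodule : IsBimodule PX.𝒫 PY.𝒫 (Low Q)
    bimodule _ _ _ _ S′⊆S S-low-T T⊆T′ s s∈S′ =
      let (t , t∈T , sQt) = S-low-T s (S′⊆S s s∈S′) in t , T⊆T′ t t∈T , sQt
    left-disjunctive : IsLeftDisjunctive PX.𝒫 PY.𝒫 (Low Q)
    left-disjunctive _ _ each-low s s∈⋁ =
      let (i , s∈Si) = witness s∈⋁ in each-low i s s∈Si
    atomic-founded : IsAtomicFounded PX.𝒫 PY.𝒫 (Low Q)
    atomic-founded A T A-atom A-low-T with PX.atom-inhabited A-atom
    ... | x , x∈A with A-low-T x x∈A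
    ... | t , t∈T , xQt =
      PY.｛ t ｝ , PY.｛｝-isAtom t , PY.｛x｝⊆ t∈T ,
      λ s s∈A → t , PY.x∈｛x｝ ,
                subst (λ u → Q u t) (sym (PX.atom-subsingleton A-atom x∈A s∈A)) xQt
    simulatory : ∀ A T → Low Q A (□ PY.𝒫 T) → Low Q (◇⁻ PX.𝒫 A) T
    simulatory A T A-low-□T w w∈◇⁻A with PX.∈◇⁻⁻ w∈◇⁻A
    ... | v , v∈A , vRw with A-low-□T v v∈A
    ... | t , t∈□T , vQt with Q-sim v t w vQt vRw
    ... | t′ , tRt′ , wQt′ = t′ , witness t∈□T t′ tRt′ , wQt′

module Restriction where

  restrict-simulation : ∀ (B B′ : CABAO) (Q : Rel (Carrier (raw B)) (Carrier (raw B′))) →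
    IsSimulatory (raw B) (raw B′) Q →
    IsSimulation (AtFrm (raw B)) (AtFrm (raw B′)) (restrict (raw B) (raw B′) Q)
  restrict-simulation B B′ Q ((bimodule , _ , atomic-founded) , simulatory)
                      (a , _) (b , _) (a′ , a′-atom) aQb a′≤◇⁻a =
    let (b′ , b′-atom , b′≤◇⁻b , a′Qb′) = atomic-founded a′ (◇⁻ (raw B′) b) a′-atom a′Q◇⁻b
    in (b′ , b′-atom) , b′≤◇⁻b , a′Qb′
    where
    module ℒ = CABAOLaws B
    module ℒ′ = CABAOLaws B′
    aQ□◇⁻b : Q a (□ (raw B′) (◇⁻ (raw B′) b))
    aQ□◇⁻b = bimodule _ _ _ _ (ℒ.⊑-refl a) aQb (ℒ′.x≤□◇⁻x b)
    a′Q◇⁻b : Q a′ (◇⁻ (raw B′) b)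
    a′Q◇⁻b = bimodule _ _ _ _ a′≤◇⁻a (simulatory a _ aQ□◇⁻b) (ℒ′.⊑-refl _)

  restrict-id : Extensionality 0ℓ 0ℓ → ∀ (B : CABAO) →
                restrict (raw B) (raw B) (IdC (raw B)) ⇔ᵣ IdRel (Atom (raw B))
  restrict-id ext B (a , a-atom) (c , c-atom) =
      (λ a≤c → Atom-≡ (atom≤atom⇒≡ a-atom c-atom a≤c))
    , λ { refl → ⊑-refl a }
    where
    open CABAOLaws B
    open Atoms ext (raw B)

  restrict-⨾ : ∀ (B B′ B″ : CABAO)
    (Q : Rel (Carrier (raw B)) (Carrier (raw B′)))
    (Q′ : Rel (Carrier (raw B′)) (Carrier (raw B″))) →
    IsAtomicFounded (raw B) (raw B′) Q → IsBimodule (raw B′) (raw B″) Q′ →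
    restrict (raw B) (raw B″) (Q ⨾ Q′) ⇔ᵣ
      (restrict (raw B) (raw B′) Q ⨾ restrict (raw B′) (raw B″) Q′)
  restrict-⨾ B B′ B″ Q Q′ Q-atomic-founded Q′-bimodule (a , a-atom) (c , _) = to , from
    where
    to : (Q ⨾ Q′) a c → Σ (Atom (raw B′)) λ b → Q a (proj₁ b) × Q′ (proj₁ b) c
    to (y , aQy , yQ′c) =
      let (b , b-atom , b≤y , aQb) = Q-atomic-founded a y a-atom aQy
      in (b , b-atom) , aQb , Q′-bimodule _ _ _ _ b≤y yQ′c (CABAOLaws.⊑-refl B″ c)
    from : (Σ (Atom (raw B′)) λ b → Q a (proj₁ b) × Q′ (proj₁ b) c) → (Q ⨾ Q′) a c
    from ((b , _) , aQb , bQ′c) = b , aQb , bQ′c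

module Counit (lem : LEM) (ext : Extensionality 0ℓ 0ℓ) (B : CABAO) where
  open Classical lem
  open CABAOLaws B
  open Atoms ext 𝔹
  open Powerset lem ext (AtFrm 𝔹)

  ⋁ₐ : Sub (Atom 𝔹) → Carrier 𝔹
  ⋁ₐ S = ⋁ 𝔹 {Σ (Atom 𝔹) (_∈ S)} (proj₁ ∘ proj₁)

  atomsBelow : Carrier 𝔹 → Sub (Atom 𝔹)
  atomsBelow x = ⟦ (λ a → proj₁ a ≤ x) ⟧

  ≤⋁ₐ : ∀ {S a} → a ∈ S → proj₁ a ≤ ⋁ₐ S
  ≤⋁ₐ a∈S = ⋁-upper _ (_ , a∈S)

  ⋁ₐ-least : ∀ {S x} → (∀ a → a ∈ S → proj₁ a ≤ x) → ⋁ₐ S ≤ x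
  ⋁ₐ-least atoms≤x = ⋁-least _ _ λ (a , a∈S) → atoms≤x a a∈S

  ⋁ₐ-mono : ∀ {S S′} → S ⊆ S′ → ⋁ₐ S ≤ ⋁ₐ S′
  ⋁ₐ-mono S⊆S′ = ⋁ₐ-least λ a a∈S → ≤⋁ₐ (S⊆S′ a a∈S)

  ≤⋁ₐ⇒∈ : ∀ {S a} → proj₁ a ≤ ⋁ₐ S → a ∈ S
  ≤⋁ₐ⇒∈ {S} {a , a-atom} a≤⋁S =
    let ((c , c∈S) , a≤c) = atom≤⋁⇒≤some lem _ a-atom a≤⋁S
    in subst (_∈ S) (sym (Atom-≡ (atom≤atom⇒≡ a-atom (proj₂ c) a≤c))) c∈S

  atomsBelow⊆⇒≤⋁ₐ : ∀ {S x} → atomsBelow x ⊆ S → x ≤ ⋁ₐ S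
  atomsBelow⊆⇒≤⋁ₐ {x = x} below⊆S =
    ⊑-trans (atomic x)
            (⋁-least _ _ λ (a , a-atom , a≤x) → ≤⋁ₐ (below⊆S (a , a-atom) (holds a≤x)))

  ε : Rel (Sub (Atom 𝔹)) (Carrier 𝔹)
  ε S x = ⋁ₐ S ≤ x

  ε⁻ : Rel (Carrier 𝔹) (Sub (Atom 𝔹))
  ε⁻ x S = x ≤ ⋁ₐ S

  ε-sim : IsSimulatory 𝒫 𝔹 ε
  ε-sim = (bimodule , left-disjunctive , atomic-founded) , simulatory
    where
    bimodule : IsBimodule 𝒫 𝔹 ε
    bimodule _ _ _ _ S′⊆S ⋁S≤x x≤x′ = ⊑-trans (⋁ₐ-mono S′⊆S) (⊑-trans ⋁S≤x x≤x′)
    left-disjunctive : IsLeftDisjunctive 𝒫 𝔹 ε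
    left-disjunctive f _ each≤x = ⋁ₐ-least {⋁ 𝒫 f} λ a a∈⋁ →
      let (i , a∈Si) = witness a∈⋁ in ⊑-trans (≤⋁ₐ a∈Si) (each≤x i)
    atomic-founded : IsAtomicFounded 𝒫 𝔹 ε
    atomic-founded A _ A-atom ⋁A≤x =
      let (a , a∈A) = atom-inhabited A-atom
      in proj₁ a , proj₂ a , ⊑-trans (≤⋁ₐ a∈A) ⋁A≤x ,
         ⋁ₐ-least λ c c∈A → ≤-reflexive (cong proj₁ (atom-subsingleton A-atom a∈A c∈A))
    simulatory : ∀ S x → ε S (□ 𝔹 x) → ε (◇⁻ 𝒫 S) x
    simulatory S x ⋁S≤□x = ⋁ₐ-least λ c c∈◇⁻S →
      let (a , a∈S , c≤◇⁻a) = ∈◇⁻⁻ c∈◇⁻S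
      in ⊑-trans c≤◇⁻a (≤□⇒◇⁻≤ (⊑-trans (≤⋁ₐ a∈S) ⋁S≤□x))

  ε⁻-sim : IsSimulatory 𝔹 𝒫 ε⁻
  ε⁻-sim = (bimodule , left-disjunctive , atomic-founded) , simulatory
    where
    bimodule : IsBimodule 𝔹 𝒫 ε⁻
    bimodule _ _ _ _ x′≤x x≤⋁S S⊆S′ = ⊑-trans x′≤x (⊑-trans x≤⋁S (⋁ₐ-mono S⊆S′))
    left-disjunctive : IsLeftDisjunctive 𝔹 𝒫 ε⁻
    left-disjunctive f S = ⋁-least f (⋁ₐ S)
    atomic-founded : IsAtomicFounded 𝔹 𝒫 ε⁻
    atomic-founded a S a-atom a≤⋁S =
      ｛ a , a-atom ｝ , ｛｝-isAtom _ , ｛x｝⊆ (≤⋁ₐ⇒∈ a≤⋁S) , ≤⋁ₐ x∈｛x｝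
    ⋁□≤□⋁ : ∀ U → ⋁ₐ (□ 𝒫 U) ≤ □ 𝔹 (⋁ₐ U)
    ⋁□≤□⋁ U = ⋁ₐ-least λ a a∈□U →
      ◇⁻≤⇒≤□ (atomsBelow⊆⇒≤⋁ₐ λ c c≤◇⁻a → witness a∈□U c (witness c≤◇⁻a))
    simulatory : ∀ x U → ε⁻ x (□ 𝒫 U) → ε⁻ (◇⁻ 𝔹 x) U
    simulatory x U x≤⋁□U = ≤□⇒◇⁻≤ (⊑-trans x≤⋁□U (⋁□≤□⋁ U))

  ε-iso₁ : (ε ⨾ ε⁻) ⇔ᵣ IdC 𝒫
  ε-iso₁ S U =
      (λ (x , ⋁S≤x , x≤⋁U) a a∈S → ≤⋁ₐ⇒∈ (⊑-trans (≤⋁ₐ a∈S) (⊑-trans ⋁S≤x x≤⋁U)))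
    , λ S⊆U → ⋁ₐ S , ⊑-refl _ , ⋁ₐ-mono S⊆U

  ε-iso₂ : (ε⁻ ⨾ ε) ⇔ᵣ IdC 𝔹
  ε-iso₂ x y =
      (λ (S , x≤⋁S , ⋁S≤y) → ⊑-trans x≤⋁S ⋁S≤y)
    , λ x≤y → atomsBelow x , atomsBelow⊆⇒≤⋁ₐ (λ _ a≤x → a≤x)
            , ⋁ₐ-least λ _ a≤x → ⊑-trans (witness a≤x) x≤y

module Naturality (lem : LEM) (ext : Extensionality 0ℓ 0ℓ) where
  open Classical lem

  η-natural : ∀ X Y (Q : Rel (W X) (W Y)) →
              (Unit.η lem ext X ⨾ restrict (PowRaw lem X) (PowRaw lem Y) (Low Q)) ⇔ᵣ
              (Q ⨾ Unit.η lem ext Y)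
  η-natural X Y Q x b =
      (λ (a , x∈a , a-low-b) → let (y , y∈b , xQy) = a-low-b x x∈a in y , xQy , y∈b)
    , λ (y , xQy , y∈b) →
        PX.｛ x ｝ₐ , PX.x∈｛x｝ ,
        λ s s∈｛x｝ → y , y∈b , subst (λ u → Q u y) (sym (witness s∈｛x｝)) xQy
    where
    module PX = Powerset lem ext X

  ε-natural : ∀ (B B′ : CABAO) (Q : Rel (Carrier (raw B)) (Carrier (raw B′))) →
              IsDirectionallyAtomic (raw B) (raw B′) Q →
              (Low (restrict (raw B) (raw B′) Q) ⨾ Counit.ε lem ext B′) ⇔ᵣ
              (Counit.ε lem ext B ⨾ Q)
  ε-natural B B′ Q (bimodule , left-disjunctive , atomic-founded) S b′ = to , from
    where
    module 𝔅 = Counit lem ext B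
    module 𝔅′ = Counit lem ext B′
    module ℒ = CABAOLaws B
    module ℒ′ = CABAOLaws B′
    to : (Low (restrict (raw B) (raw B′) Q) ⨾ 𝔅′.ε) S b′ → (𝔅.ε ⨾ Q) S b′
    to (T , S-low-T , ⋁T≤b′) =
      𝔅.⋁ₐ S , ℒ.⊑-refl _ ,
      left-disjunctive _ b′ λ (a , a∈S) →
        let (t , t∈T , aQt) = S-low-T a a∈S
        in bimodule _ _ _ _ (ℒ.⊑-refl _) aQt (ℒ′.⊑-trans (𝔅′.≤⋁ₐ t∈T) ⋁T≤b′)
    from : (𝔅.ε ⨾ Q) S b′ → (Low (restrict (raw B) (raw B′) Q) ⨾ 𝔅′.ε) S b′
    from (b , ⋁S≤b , bQb′) =
      𝔅′.atomsBelow b′ , S-low-atomsBelow , 𝔅′.⋁ₐ-least λ _ t≤b′ → witness t≤b′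
      where
      S-low-atomsBelow : Low (restrict (raw B) (raw B′) Q) S (𝔅′.atomsBelow b′)
      S-low-atomsBelow (a , a-atom) a∈S =
        let aQb′ = bimodule _ _ _ _ (ℒ.⊑-trans (𝔅.≤⋁ₐ a∈S) ⋁S≤b) bQb′ (ℒ′.⊑-refl b′)
            (t , t-atom , t≤b′ , aQt) = atomic-founded a b′ a-atom aQb′
        in (t , t-atom) , holds t≤b′ , aQt

mainTheorem3 : (lem : LEM) → Extensionality 0ℓ 0ℓ → LowAtomsEquivalence lem
mainTheorem3 lem ext = record
  { Pow-isCABAO         = Powerset.Pow-isCABAO lem ext
  ; Low-simulatory      = Low-simulatory
  ; Low-id              = λ _ → Low-id
  ; Low-⨾               = λ _ _ _ Q Q′ _ _ → Low-⨾ Q Q′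
  ; restrict-simulation = restrict-simulation
  ; restrict-id         = restrict-id ext
  ; restrict-⨾          = λ B B′ B″ Q Q′ ((_ , _ , Q-atomic-founded) , _)
                                        ((Q′-bimodule , _) , _) →
                            restrict-⨾ B B′ B″ Q Q′ Q-atomic-founded Q′-bimodule
  ; η                   = Unit.η lem ext
  ; η⁻                  = Unit.η⁻ lem ext
  ; η-sim               = Unit.η-sim lem ext
  ; η⁻-sim              = Unit.η⁻-sim lem ext
  ; η-iso₁              = Unit.η-iso₁ lem ext
  ; η-iso₂              = Unit.η-iso₂ lem ext
  ; η-natural           = λ X Y Q _ → η-natural X Y Q
  ; ε                   = Counit.ε lem ext
  ; ε⁻                  = Counit.ε⁻ lem ext
  ; ε-sim               = Counit.ε-sim lem ext
  ; ε⁻-sim              = Counit.ε⁻-sim lem ext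
  ; ε-iso₁              = Counit.ε-iso₁ lem ext
  ; ε-iso₂              = Counit.ε-iso₂ lem ext
  ; ε-natural           = λ B B′ Q Q-simulatory → ε-natural B B′ Q (proj₁ Q-simulatory)
  }
  where
  open LowerLifting lem ext
  open Restriction
  open Naturality lem ext
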